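{- Let $G$ be a $2$-regular uniform hypergraph with an odd number of edges. If $G$ is connected, then $G$ is minimal non-odd-bipartite.
   Context: A hypergraph has a finite vertex set and an edge set of distinct nonempty subsets, with no isolated vertices; it is $k$-uniform if every edge has $k$ vertices, $2$-regular if every vertex lies in exactly two edges, and connected if any two vertices are joined by a walk $v_0e_1v_1\dots e_tv_t$ with $\{v_{i-1},v_i\}\subseteq e_i$. For $k$ even, a $k$-uniform hypergraph $G$ is odd-bipartite if there is a bipartition $\{U,U^c\}$ of $V(G)$ such that every edge meets $U$ (and hence $U^c$) in an odd number of vertices; it is minimal non-odd-bipartite if it is not odd-bipartite but $G-e$ (delete the edge $e$ from the edge set) is odd-bipartite for every edge $e$. (For a $2$-regular $k$-uniform hypergraph with $n$ vertices and $m$ edges, $2n=km$, so $m$ odd forces $k$ even.) -}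

module Defs where

open import Data.Nat using (ℕ; _%_; suc)
open import Data.Fin using (Fin)
open import Data.Fin.Subset using (Subset; _∈_; _∩_; ∣_∣; Nonempty)
open import Data.Vec using (tabulate; lookup)
open import Data.Product using (Σ; ∃; _×_)
open import Relation.Binary.PropositionalEquality using (_≡_; _≢_)
open import Relation.Nullary using (¬_)
open import Function.Definitions using (Injective)

record Hypergraph : Set where
  field
    n        : ℕ
    m        : ℕ
    edge     : Fin m → Subset n
    distinct : Injective _≡_ _≡_ edge
    nonempty : ∀ i → Nonempty (edge i)
    noIsolated : ∀ (v : Fin n) → ∃ λ i → v ∈ edge i

open Hypergraph public

Uniform : ℕ → Hypergraph → Set
Uniform k G = ∀ i → ∣ edge G i ∣ ≡ k

degree : (G : Hypergraph) → Fin (n G) → ℕ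
degree G v = ∣ tabulate (λ i → lookup (edge G i) v) ∣

TwoRegular : Hypergraph → Set
TwoRegular G = ∀ v → degree G v ≡ 2

data Walk (G : Hypergraph) : Fin (n G) → Fin (n G) → Set where
  here : ∀ {u} → Walk G u u
  step : ∀ {u w v} (i : Fin (m G)) → u ∈ edge G i → w ∈ edge G i →
         Walk G w v → Walk G u v

Connected : Hypergraph → Set
Connected G = ∀ u v → Walk G u v

Odd : ℕ → Set
Odd x = x % 2 ≡ 1

OddBipartiteFamily : {I : Set} (n : ℕ) → (I → Subset n) → Set
OddBipartiteFamily {I} n E = ∃ λ (U : Subset n) → ∀ (i : I) → Odd ∣ E i ∩ U ∣

OddBipartite : Hypergraph → Set
OddBipartite G = OddBipartiteFamily (n G) (edge G)

deleteEdge : (G : Hypergraph) (e : Fin (m G)) → Σ (Fin (m G)) (λ j → j ≢ e) → Subset (n G)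
deleteEdge G e (j Data.Product., _) = edge G j

MinimalNonOddBipartite : Hypergraph → Set
MinimalNonOddBipartite G =
  ¬ OddBipartite G × (∀ (e : Fin (m G)) → OddBipartiteFamily (n G) (deleteEdge G e))

-- Over F₂, let B be the m × n edge–vertex incidence matrix of G.  A vertex set U
-- meets every edge oddly iff B U = 𝟙, so G is odd-bipartite iff 𝟙 ∈ im B.  By
-- 2-regularity every column of B has two ones, so 𝟙ᵀ B = 0: every vector of im B
-- has even weight, while 𝟙 has odd weight m.  Conversely, a vertex w lying in the
-- edges i ≠ j gives B δ_w = δᵢ + δⱼ; composing along walks, connectivity yields
-- δᵢ + δₑ ∈ im B for all i, and the sum of these over i is 1 at every edge but e,
-- which makes G − e odd-bipartite.
module Submission where

open import Defs
open import Algebra.Bundles using (CommutativeRing)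
open import Data.Bool.Base using (Bool; true; false; not; _∧_; _xor_)
open import Data.Bool.Properties
  using (xor-∧-commutativeRing; not-involutive; xor-same; xor-assoc; xor-identityʳ;
         ∧-identityʳ; ∧-zeroʳ; ∧-distribˡ-xor)
open import Data.Fin.Base using (Fin; zero; suc)
open import Data.Fin.Properties using (_≟_)
open import Data.Fin.Subset using (Subset; inside; outside; _∈_; _∉_; _∩_; _-_; ∣_∣)
open import Data.Fin.Subset.Properties using (x∈p∧x≢y⇒x∈p-y; x∈p⇒∣p-x∣<∣p∣)
open import Data.Nat.Base using (ℕ; zero; suc; _≤_; s≤s; z≤n)
open import Data.Nat.Properties using (≤-trans; n≮n)
open import Data.Product.Base using (_,_; proj₁; proj₂; ∃)
open import Data.Vec.Base using ([]; _∷_; lookup; tabulate)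
open import Data.Vec.Properties using ([]=⇒lookup; lookup⇒[]=; lookup-zipWith; lookup∘tabulate)
open import Function.Base using (_∘_)
open import Function.Bundles using (_⇔_; mk⇔; Equivalence)
open import Relation.Binary.PropositionalEquality
open import Relation.Nullary using (¬_; yes; no; does; contradiction)
open import Relation.Nullary.Decidable using (dec-false)

open import Algebra.Properties.Semiring.Sum (CommutativeRing.semiring xor-∧-commutativeRing)
open import Algebra.Definitions.RawMonoid (CommutativeRing.+-rawMonoid xor-∧-commutativeRing)
  using (_×_)

open ≡-Reasoning

Odd⇔×true : ∀ n → Odd n ⇔ n × true ≡ true
Odd⇔×true zero          = mk⇔ (λ ()) (λ ())
Odd⇔×true (suc zero)    = mk⇔ (λ _ → refl) (λ _ → refl)
Odd⇔×true (suc (suc n)) =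
  mk⇔ (λ odd → trans (not-involutive _) (to odd))
      (λ eq → from (trans (sym (not-involutive _)) eq))
  where open Equivalence (Odd⇔×true n)

∑-lookup : ∀ {n} (p : Subset n) → sum (lookup p) ≡ ∣ p ∣ × true
∑-lookup []            = refl
∑-lookup (inside ∷ p)  = cong not (∑-lookup p)
∑-lookup (outside ∷ p) = ∑-lookup p

Odd∣p∩q∣⇔∑≡true : ∀ {n} (p q : Subset n) →
                  Odd ∣ p ∩ q ∣ ⇔ ∑[ v < n ] (lookup p v ∧ lookup q v) ≡ true
Odd∣p∩q∣⇔∑≡true p q = subst (λ b → Odd ∣ p ∩ q ∣ ⇔ b ≡ true) ∣p∩q∣×true≡∑ (Odd⇔×true ∣ p ∩ q ∣)
  where
  ∣p∩q∣×true≡∑ : ∣ p ∩ q ∣ × true ≡ ∑[ v < _ ] (lookup p v ∧ lookup q v)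
  ∣p∩q∣×true≡∑ = trans (sym (∑-lookup (p ∩ q))) (sum-cong-≗ (λ v → lookup-zipWith _∧_ v p q))

lookup-∉ : ∀ {n} {p : Subset n} {x} → x ∉ p → lookup p x ≡ outside
lookup-∉ {p = p} {x} x∉p with lookup p x in eq
... | inside  = contradiction (lookup⇒[]= x p eq) x∉p
... | outside = refl

three-elements⇒3≤∣p∣ : ∀ {n} {p : Subset n} {x y z} → x ∈ p → y ∈ p → z ∈ p →
                       y ≢ x → z ≢ x → z ≢ y → 3 ≤ ∣ p ∣
three-elements⇒3≤∣p∣ {p = p} {x} {y} x∈p y∈p z∈p y≢x z≢x z≢y =
  ≤-trans (s≤s (≤-trans (s≤s 1≤∣p-x-y∣) (x∈p⇒∣p-x∣<∣p∣ y∈p-x))) (x∈p⇒∣p-x∣<∣p∣ x∈p)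
  where
  y∈p-x = x∈p∧x≢y⇒x∈p-y y∈p y≢x
  1≤∣p-x-y∣ : 1 ≤ ∣ p - x - y ∣
  1≤∣p-x-y∣ =
    ≤-trans (s≤s z≤n) (x∈p⇒∣p-x∣<∣p∣ (x∈p∧x≢y⇒x∈p-y (x∈p∧x≢y⇒x∈p-y z∈p z≢x) z≢y))

δ : ∀ {n} → Fin n → Fin n → Bool
δ i j = does (i ≟ j)

∑-sift : ∀ {n} (f : Fin n → Bool) (i : Fin n) → ∑[ j < n ] (f j ∧ δ i j) ≡ f i
∑-sift {suc n} f zero = begin
  (f zero ∧ true) xor ∑[ j < n ] (f (suc j) ∧ false)
    ≡⟨ cong₂ _xor_ (∧-identityʳ (f zero))
                   (trans (sum-cong-≗ (∧-zeroʳ ∘ f ∘ suc)) (sum-replicate-zero n)) ⟩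
  f zero xor false
    ≡⟨ xor-identityʳ (f zero) ⟩
  f zero ∎
∑-sift {suc n} f (suc i) = trans (cong (_xor ∑[ j < n ] (f (suc j) ∧ δ i j)) (∧-zeroʳ (f zero)))
                                (∑-sift (f ∘ suc) i)

xor-cancel-middle : ∀ a b c → (a xor b) xor (b xor c) ≡ a xor c
xor-cancel-middle a b c = begin
  (a xor b) xor (b xor c) ≡⟨ xor-assoc a b (b xor c) ⟩
  a xor (b xor (b xor c)) ≡⟨ cong (a xor_) (sym (xor-assoc b b c)) ⟩
  a xor ((b xor b) xor c) ≡⟨ cong (λ t → a xor (t xor c)) (xor-same b) ⟩
  a xor c                 ∎

module _ (G : Hypergraph) where

  incidentEdges : Fin (n G) → Subset (m G)
  incidentEdges v = tabulate (λ i → lookup (edge G i) v)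

  ∈-incidentEdges : ∀ {v i} → v ∈ edge G i → i ∈ incidentEdges v
  ∈-incidentEdges {v} {i} v∈i =
    lookup⇒[]= i _ (trans (lookup∘tabulate _ i) ([]=⇒lookup v∈i))

  ∑-incidence : ∀ v → ∑[ i < m G ] lookup (edge G i) v ≡ degree G v × true
  ∑-incidence v = trans (sym (sum-cong-≗ (lookup∘tabulate (λ i → lookup (edge G i) v)))) (∑-lookup (incidentEdges v))

  -- ⟨ i ∣ U ⟩ is the i-th entry of B U over F₂, and Realisable b says b ∈ im B.
  ⟨_∣_⟩ : Fin (m G) → (Fin (n G) → Bool) → Bool
  ⟨ i ∣ U ⟩ = ∑[ v < n G ] (lookup (edge G i) v ∧ U v)

  Realisable : (Fin (m G) → Bool) → Set
  Realisable b = ∃ λ U → ∀ i → ⟨ i ∣ U ⟩ ≡ b i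

  realisable-resp : ∀ {b c} → b ≗ c → Realisable b → Realisable c
  realisable-resp b≗c (U , BU≡b) = U , λ i → trans (BU≡b i) (b≗c i)

  realisable-zero : Realisable (λ _ → false)
  realisable-zero = (λ _ → false) , λ i →
    trans (sum-cong-≗ (∧-zeroʳ ∘ lookup (edge G i))) (sum-replicate-zero (n G))

  realisable-xor : ∀ {b c} → Realisable b → Realisable c → Realisable (λ i → b i xor c i)
  realisable-xor (U , BU≡b) (W , BW≡c) = (λ v → U v xor W v) , λ i → begin
    ⟨ i ∣ (λ v → U v xor W v) ⟩
      ≡⟨ sum-cong-≗ (λ v → ∧-distribˡ-xor (lookup (edge G i) v) (U v) (W v)) ⟩
    ∑[ v < n G ] ((lookup (edge G i) v ∧ U v) xor (lookup (edge G i) v ∧ W v))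
      ≡⟨ ∑-distrib-+ (λ v → lookup (edge G i) v ∧ U v) (λ v → lookup (edge G i) v ∧ W v) ⟩
    ⟨ i ∣ U ⟩ xor ⟨ i ∣ W ⟩
      ≡⟨ cong₂ _xor_ (BU≡b i) (BW≡c i) ⟩
    _ ∎

  realisable-∑ : ∀ {k} (b : Fin k → Fin (m G) → Bool) → (∀ j → Realisable (b j)) →
                 Realisable (λ i → ∑[ j < k ] b j i)
  realisable-∑ {k} b realise = (λ v → ∑[ j < k ] U j v) , λ i → begin
    ⟨ i ∣ (λ v → ∑[ j < k ] U j v) ⟩
      ≡⟨ sum-cong-≗ (λ v → *-distribˡ-sum (lookup (edge G i) v) (λ j → U j v)) ⟩
    ∑[ v < n G ] ∑[ j < k ] (lookup (edge G i) v ∧ U j v)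
      ≡⟨ ∑-comm (λ v j → lookup (edge G i) v ∧ U j v) ⟩
    ∑[ j < k ] ⟨ i ∣ U j ⟩
      ≡⟨ sum-cong-≗ (λ j → proj₂ (realise j) i) ⟩
    _ ∎
    where
    U : Fin k → Fin (n G) → Bool
    U j = proj₁ (realise j)

  realisable⇒oddBipartite : ∀ {I : Set} (f : I → Fin (m G)) {b} → Realisable b →
                            (∀ i → b (f i) ≡ true) → OddBipartiteFamily (n G) (edge G ∘ f)
  realisable⇒oddBipartite f (U , BU≡b) b∘f≡true = tabulate U , λ i →
    Equivalence.from (Odd∣p∩q∣⇔∑≡true (edge G (f i)) (tabulate U)) (begin
      ∑[ v < n G ] (lookup (edge G (f i)) v ∧ lookup (tabulate U) v)
        ≡⟨ sum-cong-≗ (λ v → cong (lookup (edge G (f i)) v ∧_) (lookup∘tabulate U v)) ⟩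
      ⟨ f i ∣ U ⟩
        ≡⟨ trans (BU≡b (f i)) (b∘f≡true i) ⟩
      true ∎)

  ∑⟨∣⟩≡false : TwoRegular G → ∀ U → ∑[ i < m G ] ⟨ i ∣ U ⟩ ≡ false
  ∑⟨∣⟩≡false reg U = begin
    ∑[ i < m G ] ∑[ v < n G ] (lookup (edge G i) v ∧ U v)
      ≡⟨ ∑-comm (λ i v → lookup (edge G i) v ∧ U v) ⟩
    ∑[ v < n G ] ∑[ i < m G ] (lookup (edge G i) v ∧ U v)
      ≡⟨ sum-cong-≗ (λ v → sym (*-distribʳ-sum (U v) (λ i → lookup (edge G i) v))) ⟩
    ∑[ v < n G ] ((∑[ i < m G ] lookup (edge G i) v) ∧ U v)
      ≡⟨ sum-cong-≗ (λ v → cong (_∧ U v) (trans (∑-incidence v) (cong (_× true) (reg v)))) ⟩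
    ∑[ v < n G ] (false ∧ U v)
      ≡⟨ sum-replicate-zero (n G) ⟩
    false ∎

  ¬oddBipartite : TwoRegular G → Odd (m G) → ¬ OddBipartite G
  ¬oddBipartite reg odd-m (U , odd-∩) = contradiction (begin
    true                           ≡⟨ sym (Equivalence.to (Odd⇔×true (m G)) odd-m) ⟩
    m G × true                     ≡⟨ sym (sum-replicate (m G)) ⟩
    ∑[ i < m G ] true              ≡⟨ sum-cong-≗ (sym ∘ odd-pattern) ⟩
    ∑[ i < m G ] ⟨ i ∣ lookup U ⟩  ≡⟨ ∑⟨∣⟩≡false reg (lookup U) ⟩
    false                          ∎) λ ()
    where
    odd-pattern : ∀ i → ⟨ i ∣ lookup U ⟩ ≡ true
    odd-pattern i = Equivalence.to (Odd∣p∩q∣⇔∑≡true (edge G i) U) (odd-∩ i)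

  incidence-at-degree-two : TwoRegular G → ∀ {w i j} → w ∈ edge G i → w ∈ edge G j → i ≢ j →
                            ∀ x → lookup (edge G x) w ≡ δ x i xor δ x j
  incidence-at-degree-two reg {w} {i} {j} w∈i w∈j i≢j x with x ≟ i | x ≟ j
  ... | yes refl | yes refl = contradiction refl i≢j
  ... | yes refl | no _     = []=⇒lookup w∈i
  ... | no _     | yes refl = []=⇒lookup w∈j
  ... | no x≢i   | no x≢j   = lookup-∉ λ w∈x → n≮n 2 (subst (3 ≤_) (reg w)
        (three-elements⇒3≤∣p∣ (∈-incidentEdges w∈i) (∈-incidentEdges w∈j)
                              (∈-incidentEdges w∈x) (i≢j ∘ sym) x≢i x≢j))

  adjacent-realisable : TwoRegular G → ∀ {w i j} → w ∈ edge G i → w ∈ edge G j →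
                        Realisable (λ x → δ x i xor δ x j)
  adjacent-realisable reg {w} {i} {j} w∈i w∈j with i ≟ j
  ... | yes refl = realisable-resp (λ x → sym (xor-same (δ x i))) realisable-zero
  ... | no i≢j   = δ w , λ x →
    trans (∑-sift (lookup (edge G x)) w) (incidence-at-degree-two reg w∈i w∈j i≢j x)

  walk-realisable : TwoRegular G → ∀ {u v i j} → Walk G u v → u ∈ edge G i → v ∈ edge G j →
                    Realisable (λ x → δ x i xor δ x j)
  walk-realisable reg here u∈i u∈j = adjacent-realisable reg u∈i u∈j
  walk-realisable reg {i = i} {j} (step k u∈k w∈k walk) u∈i v∈j =
    realisable-resp (λ x → xor-cancel-middle (δ x i) (δ x k) (δ x j))
      (realisable-xor (adjacent-realisable reg u∈i u∈k) (walk-realisable reg walk w∈k v∈j))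

  pair-realisable : TwoRegular G → Connected G → ∀ i j → Realisable (λ x → δ x i xor δ x j)
  pair-realisable reg conn i j with nonempty G i | nonempty G j
  ... | u , u∈i | v , v∈j = walk-realisable reg (conn u v) u∈i v∈j

  deleteEdge-oddBipartite : TwoRegular G → Connected G → ∀ e →
                            OddBipartiteFamily (n G) (deleteEdge G e)
  deleteEdge-oddBipartite reg conn e =
    realisable⇒oddBipartite proj₁ (realisable-∑ _ (λ j → pair-realisable reg conn j e))
      λ (x , x≢e) → begin
        ∑[ j < m G ] (δ x j xor δ x e)              ≡⟨ ∑-distrib-+ (δ x) (λ _ → δ x e) ⟩
        ∑[ j < m G ] δ x j xor ∑[ j < m G ] δ x e
          ≡⟨ cong₂ _xor_ (∑-sift (λ _ → true) x)
                         (trans (sum-cong-≗ {m G} (λ _ → dec-false (x ≟ e) x≢e))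
                                (sum-replicate-zero (m G))) ⟩
        true                                        ∎

lemma4p2 : (G : Hypergraph) (k : ℕ) → Uniform k G → TwoRegular G →
    Odd (m G) → Connected G → MinimalNonOddBipartite G
lemma4p2 G _ _ reg odd-m conn = ¬oddBipartite G reg odd-m , deleteEdge-oddBipartite G reg conn
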